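{- Up to equivalence, there are exactly two $4\times 8$ partial Hadamard matrices, namely $I=(W_4\ W_4)$ and $J=(W_4\ K_4)$ (horizontal concatenations of $4\times4$ blocks).
   Context: A partial Hadamard matrix is a matrix $H\in M_{M\times N}(\pm1)$ whose rows are pairwise orthogonal in $\mathbb{R}^N$. Two such matrices are equivalent if one can pass from one to the other by permuting the rows, permuting the columns, and multiplying rows or columns by $-1$. Here $W_4=\begin{pmatrix}1&1&1&1\\1&-1&1&-1\\1&1&-1&-1\\1&-1&-1&1\end{pmatrix}$ and $K_4=\begin{pmatrix}-1&1&1&1\\1&-1&1&1\\1&1&-1&1\\1&1&1&-1\end{pmatrix}$. -}

module Defs where

open import Data.Nat using (ℕ; zero; suc)
open import Data.Fin using (Fin; zero; suc)
open import Data.Fin.Permutation using (Permutation′; _⟨$⟩ʳ_)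
open import Data.Integer using (ℤ; +_; -_; _+_; _*_; 1ℤ; -1ℤ)
open import Data.Product using (Σ; _×_; ∃)
open import Data.Sum using (_⊎_)
open import Relation.Binary.PropositionalEquality using (_≡_; _≢_)

Matrix : ℕ → ℕ → Set
Matrix m n = Fin m → Fin n → ℤ

IsSign : ℤ → Set
IsSign x = x ≡ 1ℤ ⊎ x ≡ -1ℤ

∑ : (n : ℕ) → (Fin n → ℤ) → ℤ
∑ zero    f = + 0
∑ (suc n) f = f zero + ∑ n (λ j → f (suc j))

rowDot : ∀ {m n} → Matrix m n → Fin m → Fin m → ℤ
rowDot {n = n} H i k = ∑ n (λ j → H i j * H k j)

IsPartialHadamard : ∀ {m n} → Matrix m n → Set
IsPartialHadamard {m} {n} H =
  (∀ i j → IsSign (H i j)) × (∀ i k → i ≢ k → rowDot H i k ≡ + 0)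

-- H and H' are equivalent: H' is obtained from H by permuting rows and
-- columns and multiplying rows and columns by -1, i.e.
--   H' i j = a i * b j * H (σ i) (τ j)
-- for permutations σ, τ and sign vectors a, b (the group generated by
-- these operations consists exactly of such transformations).
Equivalent : ∀ {m n} → Matrix m n → Matrix m n → Set
Equivalent {m} {n} H H' =
  Σ (Permutation′ m) λ σ → Σ (Permutation′ n) λ τ →
  Σ (Fin m → ℤ) λ a → Σ (Fin n → ℤ) λ b →
  (∀ i → IsSign (a i)) × (∀ j → IsSign (b j)) ×
  (∀ i j → H' i j ≡ a i * b j * H (σ ⟨$⟩ʳ i) (τ ⟨$⟩ʳ j))

private
  p n : ℤ
  p = 1ℤ
  n = -1ℤ

W₄ : Matrix 4 4
W₄ zero                   = λ { zero → p ; (suc zero) → p ; (suc (suc zero)) → p ; (suc (suc (suc zero))) → p }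
W₄ (suc zero)             = λ { zero → p ; (suc zero) → n ; (suc (suc zero)) → p ; (suc (suc (suc zero))) → n }
W₄ (suc (suc zero))       = λ { zero → p ; (suc zero) → p ; (suc (suc zero)) → n ; (suc (suc (suc zero))) → n }
W₄ (suc (suc (suc zero))) = λ { zero → p ; (suc zero) → n ; (suc (suc zero)) → n ; (suc (suc (suc zero))) → p }

K₄ : Matrix 4 4
K₄ zero                   = λ { zero → n ; (suc zero) → p ; (suc (suc zero)) → p ; (suc (suc (suc zero))) → p }
K₄ (suc zero)             = λ { zero → p ; (suc zero) → n ; (suc (suc zero)) → p ; (suc (suc (suc zero))) → p }
K₄ (suc (suc zero))       = λ { zero → p ; (suc zero) → p ; (suc (suc zero)) → n ; (suc (suc (suc zero))) → p }
K₄ (suc (suc (suc zero))) = λ { zero → p ; (suc zero) → p ; (suc (suc zero)) → p ; (suc (suc (suc zero))) → n }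

hcat : Matrix 4 4 → Matrix 4 4 → Matrix 4 8
hcat A B i zero = A i zero
hcat A B i (suc zero) = A i (suc zero)
hcat A B i (suc (suc zero)) = A i (suc (suc zero))
hcat A B i (suc (suc (suc zero))) = A i (suc (suc (suc zero)))
hcat A B i (suc (suc (suc (suc j)))) = B i j

I-mat : Matrix 4 8
I-mat = hcat W₄ W₄

J-mat : Matrix 4 8
J-mat = hcat W₄ K₄

module Submission where

-- Transforming H into H′ᵢⱼ = aᵢ bⱼ H_{σi,τj} multiplies the product of
-- column j by (∏ aᵢ)·bⱼᵐ; for an even number m of rows this factor is independent of j.
-- All column products of I equal 1, while those of J are not all equal, so I ≁ J.
--
-- Multiplying each column of a partial Hadamard H by its first entry
-- turns column j into (1, uⱼ, vⱼ, wⱼ); its type (uⱼ, vⱼ, wⱼ) ∈ {±1}³ is coded in Fin 8.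
-- Orthogonality of the rows says that u, v, w sum to zero and are pairwise orthogonal.
-- Writing the indicator of a type as a sum of characters of {±1}³, every character but
-- the top one χ(a, b, c) = abc cancels, so the number kₓ of columns of type x satisfies
-- 8 kₓ = 8 + χ(x) ∑ⱼ uⱼvⱼwⱼ. The profile k is therefore fixed by the number t ≤ 2 of
-- columns of type (+, +, +), and the three possible profiles are those of I with its
-- last row negated (t = 0), of J (t = 1) and of I (t = 2). Finally, two sign matrices
-- with the same profile have the same normalised columns up to order, hence are
-- equivalent through a column permutation and column signs.

open import Defs
open import Data.Empty using (⊥-elim)
open import Data.Fin as Fin using (Fin; zero; suc; punchIn; combine; remQuot)
open import Data.Fin.Permutation as Perm using (Permutation′; _⟨$⟩ʳ_; insert; insert-punchIn)
open import Data.Fin.Properties using (all?)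
open import Data.Integer as ℤ using (ℤ; +_; -_; _+_; _*_; _^_; 1ℤ; -1ℤ)
import Data.Integer.Properties as ℤₚ
open import Data.Integer.Tactic.RingSolver using (solve-∀)
open import Data.Nat as ℕ using (ℕ; zero; suc; _∸_; _≤_; z≤n; s≤s)
import Data.Nat.Properties as ℕₚ
open import Algebra.Properties.CommutativeSemigroup ℕₚ.+-commutativeSemigroup using (x∙yz≈y∙xz)
open import Data.Product using (Σ; _×_; _,_; proj₁; proj₂)
open import Data.Sum as Sum using (_⊎_; inj₁; inj₂)
open import Data.Unit using (tt)
open import Data.Vec using (Vec; []; _∷_; tabulate; lookup)
open import Data.Vec.Properties using (lookup∘tabulate)
open import Function using (_∘_)
open import Relation.Binary.Definitions using (DecidableEquality)
open import Relation.Binary.PropositionalEquality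
open import Relation.Nullary using (¬_; Dec; yes; no; ¬?; _×-dec_; _⊎-dec_; _→-dec_)
open import Relation.Nullary.Decidable using (toWitness; toWitnessFalse)
open ≡-Reasoning

open import Algebra.Properties.Semiring.Sum ℤₚ.+-*-semiring
  using (sum; sum-cong-≗; ∑-distrib-+; *-distribˡ-sum)
open import Algebra.Properties.CommutativeMonoid.Sum ℤₚ.*-1-commutativeMonoid
  using ()
  renaming (sum to prod; ∑-distrib-+ to prod-distrib; sum-permute to prod-permute;
            sum-cong-≗ to prod-cong)

sign? : (x : ℤ) → Dec (IsSign x)
sign? x = (x ℤ.≟ 1ℤ) ⊎-dec (x ℤ.≟ -1ℤ)

sign-mul : ∀ {x y} → IsSign x → IsSign y → IsSign (x * y)
sign-mul (inj₁ refl) (inj₁ refl) = inj₁ refl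
sign-mul (inj₁ refl) (inj₂ refl) = inj₂ refl
sign-mul (inj₂ refl) (inj₁ refl) = inj₂ refl
sign-mul (inj₂ refl) (inj₂ refl) = inj₁ refl

sign-square : ∀ {x} → IsSign x → x * x ≡ 1ℤ
sign-square (inj₁ refl) = refl
sign-square (inj₂ refl) = refl

sign-cancel : ∀ {x} → IsSign x → ∀ y → x * (x * y) ≡ y
sign-cancel {x} s y = trans (sym (ℤₚ.*-assoc x x y)) (trans (cong (_* y) (sign-square s)) (ℤₚ.*-identityˡ y))

sign-cancel-pair : ∀ {h} → IsSign h → ∀ x y → (h * x) * (h * y) ≡ x * y
sign-cancel-pair {h} s x y = trans (regroup h x y) (trans (cong (_* (x * y)) (sign-square s)) (ℤₚ.*-identityˡ (x * y)))
  where
  regroup : ∀ h x y → (h * x) * (h * y) ≡ (h * h) * (x * y)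
  regroup = solve-∀

sign-pow : ∀ {x} → IsSign x → ∀ k → IsSign (x ^ k)
sign-pow s zero    = inj₁ refl
sign-pow s (suc k) = sign-mul s (sign-pow s k)

sign-even-pow : ∀ {x} → IsSign x → ∀ k → x ^ (k ℕ.+ k) ≡ 1ℤ
sign-even-pow {x} s k = trans (ℤₚ.^-distribˡ-+-* x k k) (sign-square (sign-pow s k))

∑≡sum : ∀ n (f : Fin n → ℤ) → ∑ n f ≡ sum f
∑≡sum zero    f = refl
∑≡sum (suc n) f = cong (_+_ (f zero)) (∑≡sum n (f ∘ suc))

sum-ones : ∀ n → sum {n} (λ _ → 1ℤ) ≡ + n
sum-ones zero    = refl
sum-ones (suc n) = trans (cong (_+_ 1ℤ) (sum-ones n)) (sym (ℤₚ.pos-+ 1 n))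

sum-linear : ∀ {n} (f g : Fin n → ℤ) k → sum (λ j → f j + k * g j) ≡ sum f + k * sum g
sum-linear f g k =
  trans (∑-distrib-+ f (λ j → k * g j)) (cong (_+_ (sum f)) (sym (*-distribˡ-sum k g)))

sum-drop : ∀ {n} (f g : Fin n → ℤ) k → sum g ≡ + 0 → sum (λ j → f j + k * g j) ≡ sum f
sum-drop f g k g≡0 = begin
  sum (λ j → f j + k * g j) ≡⟨ sum-linear f g k ⟩
  sum f + k * sum g         ≡⟨ cong (λ s → sum f + k * s) g≡0 ⟩
  sum f + k * + 0           ≡⟨ x+k*0≡x (sum f) k ⟩
  sum f                     ∎
  where
  x+k*0≡x : ∀ x k → x + k * + 0 ≡ x
  x+k*0≡x = solve-∀

balanced-sum : ∀ {n} (a b c : ℤ) (u v w : Fin n → ℤ) →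
  sum u ≡ + 0 → sum v ≡ + 0 → sum w ≡ + 0 →
  sum (λ j → u j * v j) ≡ + 0 → sum (λ j → u j * w j) ≡ + 0 → sum (λ j → v j * w j) ≡ + 0 →
  sum (λ j → (1ℤ + a * u j) * ((1ℤ + b * v j) * (1ℤ + c * w j)))
    ≡ + n + a * b * c * sum (λ j → u j * v j * w j)
balanced-sum {n} a b c u v w Σu Σv Σw Σuv Σuw Σvw = begin
  sum (λ j → (1ℤ + a * u j) * ((1ℤ + b * v j) * (1ℤ + c * w j)))
    ≡⟨ sum-cong-≗ (λ j → expand a b c (u j) (v j) (w j)) ⟩
  sum (λ j → lower j + a * b * c * (u j * v j * w j))
    ≡⟨ sum-linear lower (λ j → u j * v j * w j) (a * b * c) ⟩
  sum lower + a * b * c * sum (λ j → u j * v j * w j)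
    ≡⟨ cong (_+ a * b * c * sum (λ j → u j * v j * w j)) lower-terms ⟩
  + n + a * b * c * sum (λ j → u j * v j * w j) ∎
  where
  l₁ l₂ l₃ l₄ l₅ lower : Fin n → ℤ
  l₁ j    = 1ℤ + a * u j
  l₂ j    = l₁ j + b * v j
  l₃ j    = l₂ j + c * w j
  l₄ j    = l₃ j + a * b * (u j * v j)
  l₅ j    = l₄ j + a * c * (u j * w j)
  lower j = l₅ j + b * c * (v j * w j)

  expand : ∀ a b c x y z → (1ℤ + a * x) * ((1ℤ + b * y) * (1ℤ + c * z))
    ≡ 1ℤ + a * x + b * y + c * z + a * b * (x * y) + a * c * (x * z) + b * c * (y * z)
      + a * b * c * (x * y * z)
  expand = solve-∀

  lower-terms : sum lower ≡ + n
  lower-terms =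
    trans (sum-drop l₅ (λ j → v j * w j) (b * c) Σvw)
    (trans (sum-drop l₄ (λ j → u j * w j) (a * c) Σuw)
    (trans (sum-drop l₃ (λ j → u j * v j) (a * b) Σuv)
    (trans (sum-drop l₂ w c Σw) (trans (sum-drop l₁ v b Σv)
    (trans (sum-drop (λ _ → 1ℤ) u a Σu) (sum-ones n))))))

-- Decidability: the defining conditions are finite checks, so statements about
-- explicit matrices are verified by evaluation.

SignMatrix : ∀ {m n} → Matrix m n → Set
SignMatrix H = ∀ i j → IsSign (H i j)

signMatrix? : ∀ {m n} (H : Matrix m n) → Dec (SignMatrix H)
signMatrix? H = all? λ i → all? λ j → sign? (H i j)

isPartialHadamard? : ∀ {m n} (H : Matrix m n) → Dec (IsPartialHadamard H)
isPartialHadamard? H =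
  signMatrix? H ×-dec
  (all? λ i → all? λ k → ¬? (i Fin.≟ k) →-dec (rowDot H i k ℤ.≟ + 0))

I-hadamard : IsPartialHadamard I-mat
I-hadamard = toWitness {a? = isPartialHadamard? I-mat} tt

J-hadamard : IsPartialHadamard J-mat
J-hadamard = toWitness {a? = isPartialHadamard? J-mat} tt

colProd : ∀ {m n} → Matrix m n → Fin n → ℤ
colProd H j = prod (λ i → H i j)

prod-const : ∀ m x → prod {m} (λ _ → x) ≡ x ^ m
prod-const zero    x = refl
prod-const (suc m) x = cong (x *_) (prod-const m x)

colProd-transform : ∀ {m n} (H : Matrix m n) (σ : Permutation′ m) (τ : Permutation′ n)
  (a : Fin m → ℤ) (b : Fin n → ℤ) j →
  prod (λ i → a i * b j * H (σ ⟨$⟩ʳ i) (τ ⟨$⟩ʳ j)) ≡ prod a * b j ^ m * colProd H (τ ⟨$⟩ʳ j)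
colProd-transform {m} H σ τ a b j = begin
  prod (λ i → a i * b j * H (σ ⟨$⟩ʳ i) (τ ⟨$⟩ʳ j))
    ≡⟨ prod-distrib (λ i → a i * b j) (λ i → H (σ ⟨$⟩ʳ i) (τ ⟨$⟩ʳ j)) ⟩
  prod (λ i → a i * b j) * prod (λ i → H (σ ⟨$⟩ʳ i) (τ ⟨$⟩ʳ j))
    ≡⟨ cong₂ _*_ (prod-distrib a (λ _ → b j)) (sym (prod-permute (λ i → H i (τ ⟨$⟩ʳ j)) σ)) ⟩
  prod a * prod {m} (λ _ → b j) * colProd H (τ ⟨$⟩ʳ j)
    ≡⟨ cong (λ p → prod a * p * colProd H (τ ⟨$⟩ʳ j)) (prod-const m (b j)) ⟩
  prod a * b j ^ m * colProd H (τ ⟨$⟩ʳ j) ∎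

ConstantColumnProduct : ∀ {m n} → Matrix m n → Set
ConstantColumnProduct H = ∀ j j′ → colProd H j ≡ colProd H j′

constantColumnProduct? : ∀ {m n} (H : Matrix m n) → Dec (ConstantColumnProduct H)
constantColumnProduct? H = all? λ j → all? λ j′ → colProd H j ℤ.≟ colProd H j′

-- All column products of I are 1; columns 0 and 4 of J have products 1 and -1.
I-constant : ConstantColumnProduct I-mat
I-constant = toWitness {a? = constantColumnProduct? I-mat} tt

J-not-constant : ¬ ConstantColumnProduct J-mat
J-not-constant = toWitnessFalse {a? = constantColumnProduct? J-mat} tt

-- With an even number of rows, the factor bⱼ^(2k) is 1, so every column product
-- changes by the same factor ∏ aᵢ: equivalence preserves constant column products.
constant-column-product-invariant : ∀ k {n} {H H′ : Matrix (k ℕ.+ k) n} →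
  Equivalent H H′ → ConstantColumnProduct H → ConstantColumnProduct H′
constant-column-product-invariant k {H = H} {H′} (σ , τ , a , b , _ , sb , eq) const j j′ =
  trans (scaled j) (trans (cong (prod a *_) (const _ _)) (sym (scaled j′)))
  where
  scaled : ∀ j → colProd H′ j ≡ prod a * colProd H (τ ⟨$⟩ʳ j)
  scaled j = begin
    colProd H′ j                                   ≡⟨ prod-cong (λ i → eq i j) ⟩
    prod (λ i → a i * b j * H (σ ⟨$⟩ʳ i) (τ ⟨$⟩ʳ j)) ≡⟨ colProd-transform H σ τ a b j ⟩
    prod a * b j ^ (k ℕ.+ k) * colProd H (τ ⟨$⟩ʳ j)  ≡⟨ cong (λ p → prod a * p * colProd H (τ ⟨$⟩ʳ j)) (sign-even-pow (sb j) k) ⟩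
    prod a * 1ℤ * colProd H (τ ⟨$⟩ʳ j)              ≡⟨ cong (_* colProd H (τ ⟨$⟩ʳ j)) (ℤₚ.*-identityʳ (prod a)) ⟩
    prod a * colProd H (τ ⟨$⟩ʳ j)                   ∎

normalised : ∀ {m n} → Matrix (suc m) n → Matrix (suc m) n
normalised H i j = H zero j * H i j

-- If a column permutation τ carries the normalised columns of H onto those of T,
-- then H and T are equivalent (σ = id, a = 1, bⱼ = T₀ⱼ · H₀,τⱼ).
normalised-match⇒equivalent : ∀ {m n} (H T : Matrix (suc m) n) (τ : Permutation′ n) →
  (∀ j → IsSign (H zero j)) → (∀ j → IsSign (T zero j)) →
  (∀ i j → normalised H i (τ ⟨$⟩ʳ j) ≡ normalised T i j) → Equivalent H T
normalised-match⇒equivalent {n = n} H T τ sH sT match =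
  Perm.id , τ , (λ _ → 1ℤ) , b , (λ _ → inj₁ refl) , (λ j → sign-mul (sT j) (sH (τ ⟨$⟩ʳ j))) , entry
  where
  b : Fin n → ℤ
  b j = T zero j * H zero (τ ⟨$⟩ʳ j)

  reassociate : ∀ t h₀ h → t * (h₀ * h) ≡ 1ℤ * (t * h₀) * h
  reassociate = solve-∀

  entry : ∀ i j → T i j ≡ 1ℤ * b j * H i (τ ⟨$⟩ʳ j)
  entry i j = begin
    T i j                                           ≡⟨ sym (sign-cancel (sT j) (T i j)) ⟩
    T zero j * normalised T i j                     ≡⟨ cong (T zero j *_) (sym (match i j)) ⟩
    T zero j * (H zero (τ ⟨$⟩ʳ j) * H i (τ ⟨$⟩ʳ j)) ≡⟨ reassociate (T zero j) _ _ ⟩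
    1ℤ * b j * H i (τ ⟨$⟩ʳ j)                        ∎

rowScale : ∀ {m n} → (Fin m → ℤ) → Matrix m n → Matrix m n
rowScale ε T i j = ε i * T i j

equivalent-rowScale : ∀ {m n} {H T : Matrix m n} (ε : Fin m → ℤ) → (∀ i → IsSign (ε i)) →
  Equivalent H (rowScale ε T) → Equivalent H T
equivalent-rowScale {H = H} {T} ε sε (σ , τ , a , b , sa , sb , eq) =
  σ , τ , (λ i → ε i * a i) , b , (λ i → sign-mul (sε i) (sa i)) , sb , entry
  where
  reassociate : ∀ e x y h → e * (x * y * h) ≡ e * x * y * h
  reassociate = solve-∀

  entry : ∀ i j → T i j ≡ ε i * a i * b j * H (σ ⟨$⟩ʳ i) (τ ⟨$⟩ʳ j)
  entry i j = begin
    T i j                                        ≡⟨ sym (sign-cancel (sε i) (T i j)) ⟩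
    ε i * rowScale ε T i j                       ≡⟨ cong (ε i *_) (eq i j) ⟩
    ε i * (a i * b j * H (σ ⟨$⟩ʳ i) (τ ⟨$⟩ʳ j))   ≡⟨ reassociate (ε i) (a i) (b j) _ ⟩
    ε i * a i * b j * H (σ ⟨$⟩ʳ i) (τ ⟨$⟩ʳ j)     ∎

module Counting {a} {A : Set a} (_≟_ : DecidableEquality A) where

  δ : A → A → ℕ
  δ y x with y ≟ x
  ... | yes _ = 1
  ... | no  _ = 0

  δ-refl : ∀ x → δ x x ≡ 1
  δ-refl x with x ≟ x
  ... | yes _  = refl
  ... | no x≢x = ⊥-elim (x≢x refl)

  count : ∀ {n} → (Fin n → A) → A → ℕ
  count {zero}  c x = 0
  count {suc n} c x = δ (c zero) x ℕ.+ count (c ∘ suc) x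

  count-punchIn : ∀ {n} (c : Fin (suc n) → A) k x →
    count c x ≡ δ (c k) x ℕ.+ count (c ∘ punchIn k) x
  count-punchIn c zero x = refl
  count-punchIn {suc n} c (suc k) x = begin
    δ (c zero) x ℕ.+ count (c ∘ suc) x
      ≡⟨ cong (δ (c zero) x ℕ.+_) (count-punchIn (c ∘ suc) k x) ⟩
    δ (c zero) x ℕ.+ (δ (c (suc k)) x ℕ.+ count (c ∘ suc ∘ punchIn k) x)
      ≡⟨ x∙yz≈y∙xz (δ (c zero) x) (δ (c (suc k)) x) _ ⟩
    δ (c (suc k)) x ℕ.+ (δ (c zero) x ℕ.+ count (c ∘ suc ∘ punchIn k) x) ∎

  count-positive : ∀ {n} (c : Fin n → A) k → 1 ≤ count c (c k)
  count-positive {suc n} c k =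
    subst (1 ≤_) (sym (trans (count-punchIn c k (c k)) (cong (ℕ._+ count (c ∘ punchIn k) (c k)) (δ-refl (c k))))) (s≤s z≤n)

  occurrence : ∀ {n} (c : Fin n → A) x → 1 ≤ count c x → Σ (Fin n) λ k → c k ≡ x
  occurrence {suc n} c x counted with c zero ≟ x
  ... | yes c₀≡x = zero , c₀≡x
  ... | no  _    with occurrence (c ∘ suc) x counted
  ...   | k , cₖ≡x = suc k , cₖ≡x

  remove-common : ∀ {n} (c t : Fin (suc n) → A) k → c k ≡ t zero →
    (∀ x → count c x ≡ count t x) → ∀ x → count (c ∘ punchIn k) x ≡ count (t ∘ suc) x
  remove-common c t k cₖ≡t₀ same x = ℕₚ.+-cancelˡ-≡ (δ (t zero) x) _ _ (begin
    δ (t zero) x ℕ.+ count (c ∘ punchIn k) x ≡⟨ cong (λ y → δ y x ℕ.+ _) (sym cₖ≡t₀) ⟩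
    δ (c k) x ℕ.+ count (c ∘ punchIn k) x    ≡⟨ sym (count-punchIn c k x) ⟩
    count c x                                ≡⟨ same x ⟩
    count t x                                ∎)

  -- Equal counts give a permutation τ with c ∘ τ = t: match t 0 with an occurrence
  -- in c, then recurse on the remaining positions.
  equal-counts⇒permutation : ∀ {n} (c t : Fin n → A) → (∀ x → count c x ≡ count t x) →
    Σ (Permutation′ n) λ τ → ∀ j → c (τ ⟨$⟩ʳ j) ≡ t j
  equal-counts⇒permutation {zero} c t same = Perm.id , λ ()
  equal-counts⇒permutation {suc n} c t same
    with occurrence c (t zero) (subst (1 ≤_) (sym (same (t zero))) (count-positive t zero))
  ... | k , cₖ≡t₀
    with equal-counts⇒permutation (c ∘ punchIn k) (t ∘ suc) (remove-common c t k cₖ≡t₀ same)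
  ... | τ , matches = insert zero k τ , extended
    where
    -- position 0 goes to k, the others as τ does, avoiding k
    extended : ∀ j → c (insert zero k τ ⟨$⟩ʳ j) ≡ t j
    extended zero    = cₖ≡t₀
    extended (suc j) = trans (cong c (insert-punchIn zero k τ j)) (matches j)

  count-sum : ∀ {n} (c : Fin n → A) x → sum (λ j → + δ (c j) x) ≡ + count c x
  count-sum {zero}  c x = refl
  count-sum {suc n} c x = cong (_+_ (+ δ (c zero) x)) (count-sum (c ∘ suc) x)

-- Column types of four-row sign matrices. A normalised column is (1, u, v, w) with
-- u, v, w = ±1; it is recorded by a code in Fin 8 = Fin (2 · (2 · 2)), read as three bits.

bit : ℤ → Fin 2
bit (+ 1) = suc zero
bit _     = zero

signOf : Fin 2 → ℤ
signOf zero       = -1ℤ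
signOf (suc zero) = 1ℤ

encode : Vec ℤ 3 → Fin 8
encode (u ∷ v ∷ w ∷ []) = combine (bit u) (combine (bit v) (bit w))

signs : Fin 8 → Vec ℤ 3
signs x = signOf high ∷ signOf middle ∷ signOf low ∷ []
  where
  high middle low : Fin 2
  high   = proj₁ (remQuot {2} 4 x)
  middle = proj₁ (remQuot {2} 2 (proj₂ (remQuot {2} 4 x)))
  low    = proj₂ (remQuot {2} 2 (proj₂ (remQuot {2} 4 x)))

signs-encode : ∀ {u v w} → IsSign u → IsSign v → IsSign w → signs (encode (u ∷ v ∷ w ∷ [])) ≡ u ∷ v ∷ w ∷ []
signs-encode (inj₁ refl) (inj₁ refl) (inj₁ refl) = refl
signs-encode (inj₁ refl) (inj₁ refl) (inj₂ refl) = refl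
signs-encode (inj₁ refl) (inj₂ refl) (inj₁ refl) = refl
signs-encode (inj₁ refl) (inj₂ refl) (inj₂ refl) = refl
signs-encode (inj₂ refl) (inj₁ refl) (inj₁ refl) = refl
signs-encode (inj₂ refl) (inj₁ refl) (inj₂ refl) = refl
signs-encode (inj₂ refl) (inj₂ refl) (inj₁ refl) = refl
signs-encode (inj₂ refl) (inj₂ refl) (inj₂ refl) = refl

column : ∀ {n} → Matrix 4 n → Fin n → Vec ℤ 3
column H j = tabulate λ r → normalised H (suc r) j

code : ∀ {n} → Matrix 4 n → Fin n → Fin 8
code H j = encode (column H j)

signs-code : ∀ {n} {H : Matrix 4 n} → SignMatrix H → ∀ j → signs (code H j) ≡ column H j
signs-code {H = H} sH j =
  signs-encode (normalised-sign (suc zero)) (normalised-sign (suc (suc zero)))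
               (normalised-sign (suc (suc (suc zero))))
  where
  normalised-sign : ∀ i → IsSign (normalised H i j)
  normalised-sign i = sign-mul (sH zero j) (sH i j)

code-match⇒normalised-match : ∀ {n} {H T : Matrix 4 n} → SignMatrix H → SignMatrix T →
  (τ : Permutation′ n) → (∀ j → code H (τ ⟨$⟩ʳ j) ≡ code T j) →
  ∀ i j → normalised H i (τ ⟨$⟩ʳ j) ≡ normalised T i j
code-match⇒normalised-match sH sT τ codes zero j =
  trans (sign-square (sH zero (τ ⟨$⟩ʳ j))) (sym (sign-square (sT zero j)))
code-match⇒normalised-match {H = H} {T} sH sT τ codes (suc r) j = begin
  normalised H (suc r) (τ ⟨$⟩ʳ j)      ≡⟨ sym (lookup∘tabulate (λ r → normalised H (suc r) (τ ⟨$⟩ʳ j)) r) ⟩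
  lookup (column H (τ ⟨$⟩ʳ j)) r       ≡⟨ cong (λ v → lookup v r) same-columns ⟩
  lookup (column T j) r               ≡⟨ lookup∘tabulate (λ r → normalised T (suc r) j) r ⟩
  normalised T (suc r) j              ∎
  where
  same-columns : column H (τ ⟨$⟩ʳ j) ≡ column T j
  same-columns = trans (sym (signs-code sH (τ ⟨$⟩ʳ j))) (trans (cong signs (codes j)) (signs-code sT j))

open Counting (Fin._≟_ {8}) using (δ; count; count-sum; equal-counts⇒permutation)

profile : ∀ {n} → Matrix 4 n → Fin 8 → ℕ
profile H = count (code H)

same-profile⇒equivalent : ∀ {n} (H T : Matrix 4 n) → SignMatrix H → SignMatrix T →
  (∀ x → profile H x ≡ profile T x) → Equivalent H T
same-profile⇒equivalent H T sH sT same =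
  let τ , codes = equal-counts⇒permutation (code H) (code T) same
  in normalised-match⇒equivalent H T τ (sH zero) (sT zero) (code-match⇒normalised-match {H = H} {T} sH sT τ codes)

-- (1 + a u)(1 + b v)(1 + c w): the sum of the eight characters χ_S(a, b, c) χ_S(u, v, w)
weight : Vec ℤ 3 → Vec ℤ 3 → ℤ
weight (a ∷ b ∷ c ∷ []) (u ∷ v ∷ w ∷ []) = (1ℤ + a * u) * ((1ℤ + b * v) * (1ℤ + c * w))

χ : Vec ℤ 3 → ℤ
χ (a ∷ b ∷ c ∷ []) = a * b * c

-- Orthogonality of characters: the weight is 8 on equal patterns and 0 otherwise.
Indicator : Fin 8 → Set
Indicator x = ∀ y → + 8 * + δ y x ≡ weight (signs x) (signs y)

indicator : ∀ x → Indicator x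
indicator = toWitness {a? = all? {P = Indicator} λ x → all? λ y → + 8 * + δ y x ℤ.≟ weight (signs x) (signs y)} tt

χ-sign : ∀ x → IsSign (χ (signs x))
χ-sign = toWitness {a? = all? λ x → sign? (χ (signs x))} tt

ifPlus : ℤ → ℕ → ℕ → ℕ
ifPlus (+ 1) p q = p
ifPlus _     p q = q

shape : ℕ → Fin 8 → ℕ
shape t x = ifPlus (χ (signs x)) t (2 ∸ t)

flip-last : Fin 4 → ℤ
flip-last (suc (suc (suc zero))) = -1ℤ
flip-last _                      = 1ℤ

I⁻ : Matrix 4 8
I⁻ = rowScale flip-last I-mat

same? : ∀ (p q : Fin 8 → ℕ) → Dec (p ≗ q)
same? p q = all? λ x → p x ℕ.≟ q x

shape-realised : ∀ t → t ≤ 2 →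
  shape t ≗ profile I⁻ ⊎ shape t ≗ profile J-mat ⊎ shape t ≗ profile I-mat
shape-realised 0 _ = inj₁ (toWitness {a? = same? (shape 0) (profile I⁻)} tt)
shape-realised 1 _ = inj₂ (inj₁ (toWitness {a? = same? (shape 1) (profile J-mat)} tt))
shape-realised 2 _ = inj₂ (inj₂ (toWitness {a? = same? (shape 2) (profile I-mat)} tt))
shape-realised (suc (suc (suc t))) (s≤s (s≤s ()))

flip-last-sign : ∀ i → IsSign (flip-last i)
flip-last-sign = toWitness {a? = all? λ i → sign? (flip-last i)} tt

I⁻-sign : SignMatrix I⁻
I⁻-sign = toWitness {a? = signMatrix? I⁻} tt

module Profile (H : Matrix 4 8) (hadamard : IsPartialHadamard H) where

  orthogonal : ∀ i k → i ≢ k → rowDot H i k ≡ + 0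
  orthogonal = proj₂ hadamard

  u v w : Fin 8 → ℤ
  u = normalised H (suc zero)
  v = normalised H (suc (suc zero))
  w = normalised H (suc (suc (suc zero)))

  normalised-sum : ∀ i → sum (normalised H i) ≡ rowDot H zero i
  normalised-sum i = sym (∑≡sum 8 (normalised H i))

  normalised-dot : ∀ i k → sum (λ j → normalised H i j * normalised H k j) ≡ rowDot H i k
  normalised-dot i k = trans (sum-cong-≗ λ j → sign-cancel-pair (proj₁ hadamard zero j) (H i j) (H k j))
                             (sym (∑≡sum 8 (λ j → H i j * H k j)))

  k : Fin 8 → ℕ
  k = profile H

  -- the only character sum not forced to vanish by orthogonality
  S : ℤ
  S = sum (λ j → u j * v j * w j)

  -- 8 kₓ = 8 + χ(x) S: the orthogonality relations kill all but the top character.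
  count-formula : ∀ x → + 8 * + k x ≡ + 8 + χ (signs x) * S
  count-formula x = begin
    + 8 * + k x                               ≡⟨ cong (+ 8 *_) (sym (count-sum (code H) x)) ⟩
    + 8 * sum (λ j → + δ (code H j) x)        ≡⟨ *-distribˡ-sum (+ 8) (λ j → + δ (code H j) x) ⟩
    sum (λ j → + 8 * + δ (code H j) x)        ≡⟨ sum-cong-≗ by-characters ⟩
    sum (λ j → weight (signs x) (column H j)) ≡⟨ top-character (signs x) ⟩
    + 8 + χ (signs x) * S                     ∎
    where
    by-characters : ∀ j → + 8 * + δ (code H j) x ≡ weight (signs x) (column H j)
    by-characters j = trans (indicator x (code H j)) (cong (weight (signs x)) (signs-code (proj₁ hadamard) j))

    top-character : ∀ s → sum (λ j → weight s (column H j)) ≡ + 8 + χ s * S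
    top-character (a ∷ b ∷ c ∷ []) = balanced-sum a b c u v w
      (trans (normalised-sum _) (orthogonal zero (suc zero) λ ()))
      (trans (normalised-sum _) (orthogonal zero (suc (suc zero)) λ ()))
      (trans (normalised-sum _) (orthogonal zero (suc (suc (suc zero))) λ ()))
      (trans (normalised-dot _ _) (orthogonal (suc zero) (suc (suc zero)) λ ()))
      (trans (normalised-dot _ _) (orthogonal (suc zero) (suc (suc (suc zero))) λ ()))
      (trans (normalised-dot _ _) (orthogonal (suc (suc zero)) (suc (suc (suc zero))) λ ()))

  same-character : ∀ x y → χ (signs x) ≡ χ (signs y) → k x ≡ k y
  same-character x y χx≡χy = ℤₚ.+-injective (ℤₚ.*-cancelˡ-≡ (+ 8) (+ k x) (+ k y) (begin
    + 8 * + k x           ≡⟨ count-formula x ⟩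
    + 8 + χ (signs x) * S ≡⟨ cong (λ c → + 8 + c * S) χx≡χy ⟩
    + 8 + χ (signs y) * S ≡⟨ sym (count-formula y) ⟩
    + 8 * + k y           ∎))

  opposite-character : ∀ x y → χ (signs x) ≡ - χ (signs y) → k x ℕ.+ k y ≡ 2
  opposite-character x y χx≡-χy = ℤₚ.+-injective (ℤₚ.*-cancelˡ-≡ (+ 8) (+ k x + + k y) (+ 2) (begin
    + 8 * (+ k x + + k y)                                 ≡⟨ ℤₚ.*-distribˡ-+ (+ 8) (+ k x) (+ k y) ⟩
    + 8 * + k x + + 8 * + k y                             ≡⟨ cong₂ _+_ (count-formula x) (count-formula y) ⟩
    (+ 8 + χ (signs x) * S) + (+ 8 + χ (signs y) * S)     ≡⟨ cong (λ c → (+ 8 + c * S) + _) χx≡-χy ⟩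
    (+ 8 + - χ (signs y) * S) + (+ 8 + χ (signs y) * S)   ≡⟨ cancel (χ (signs y)) S ⟩
    + 16                                                  ∎))
    where
    cancel : ∀ c S → (+ 8 + - c * S) + (+ 8 + c * S) ≡ + 16
    cancel = solve-∀

  -- the type (+, +, +), with top character +1
  all-plus : Fin 8
  all-plus = suc (suc (suc (suc (suc (suc (suc zero))))))

  k-shape : ∀ x → k x ≡ shape (k all-plus) x
  k-shape x = by-sign (χ-sign x)
    where
    by-sign : IsSign (χ (signs x)) → k x ≡ ifPlus (χ (signs x)) (k all-plus) (2 ∸ k all-plus)
    by-sign (inj₁ χ≡1) =
      subst (λ c → k x ≡ ifPlus c (k all-plus) _) (sym χ≡1) (same-character x all-plus χ≡1)
    by-sign (inj₂ χ≡-1) =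
      subst (λ c → k x ≡ ifPlus c _ (2 ∸ k all-plus)) (sym χ≡-1) (begin
        k x                            ≡⟨ sym (ℕₚ.m+n∸m≡n (k all-plus) (k x)) ⟩
        k all-plus ℕ.+ k x ∸ k all-plus ≡⟨ cong (_∸ k all-plus) (opposite-character all-plus x (cong -_ (sym χ≡-1))) ⟩
        2 ∸ k all-plus                  ∎)

  k-all-plus≤2 : k all-plus ≤ 2
  k-all-plus≤2 = subst (k all-plus ≤_) (opposite-character all-plus zero refl) (ℕₚ.m≤m+n (k all-plus) (k zero))

  profile-cases : profile H ≗ profile I⁻ ⊎ profile H ≗ profile J-mat ⊎ profile H ≗ profile I-mat
  profile-cases = Sum.map via (Sum.map via via) (shape-realised (k all-plus) k-all-plus≤2)
    where
    via : ∀ {q} → shape (k all-plus) ≗ q → k ≗ q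
    via same x = trans (k-shape x) (same x)

classification : (H : Matrix 4 8) → IsPartialHadamard H → Equivalent H I-mat ⊎ Equivalent H J-mat
classification H hadamard = by-profile (Profile.profile-cases H hadamard)
  where
  by-profile : profile H ≗ profile I⁻ ⊎ profile H ≗ profile J-mat ⊎ profile H ≗ profile I-mat →
    Equivalent H I-mat ⊎ Equivalent H J-mat
  by-profile (inj₁ as-I⁻) = inj₁ (equivalent-rowScale {H = H} {T = I-mat} flip-last flip-last-sign
    (same-profile⇒equivalent H I⁻ (proj₁ hadamard) I⁻-sign as-I⁻))
  by-profile (inj₂ (inj₁ as-J)) = inj₂ (same-profile⇒equivalent H J-mat (proj₁ hadamard) (proj₁ J-hadamard) as-J)
  by-profile (inj₂ (inj₂ as-I)) = inj₁ (same-profile⇒equivalent H I-mat (proj₁ hadamard) (proj₁ I-hadamard) as-I)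

proposition1p17 : IsPartialHadamard I-mat × IsPartialHadamard J-mat × ¬ Equivalent I-mat J-mat
    × ((H : Matrix 4 8) → IsPartialHadamard H → Equivalent H I-mat ⊎ Equivalent H J-mat)
proposition1p17 =
  I-hadamard , J-hadamard ,
  (λ I≈J → J-not-constant (constant-column-product-invariant 2 {H = I-mat} {J-mat} I≈J I-constant)) ,
  classification
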